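{- Let $\mu\geq 1$ be an integer and let $f_{m,n}(z)=\sum_{j=0}^{n}\binom{n}{j}z^{\binom{j}{m}}$. Then $z+1$ divides $f_{2^\mu,n}(z)$ (equivalently $f_{2^\mu,n}(-1)=0$) for every $n=k\cdot 2^{\mu+1}-1$ with $k=1,2,3,\ldots$.
   Context: Here $\binom{j}{m}=0$ for $0\le j<m$. -}

module Defs where

open import Data.Nat using (ℕ; zero; suc)
open import Data.Nat.Combinatorics using (_C_)
open import Data.Integer using (ℤ; +_; -_; _+_; _*_; _^_)

sumTo : ℕ → (ℕ → ℤ) → ℤ
sumTo zero    g = g 0
sumTo (suc n) g = sumTo n g + g (suc n)

f : ℕ → ℕ → ℤ → ℤ
f m n z = sumTo n (λ j → (+ (n C j)) * (z ^ (j C m)))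

{-# OPTIONS --safe #-}
-- By Lucas's theorem at the prime 2, C(j, 2^μ) is odd exactly when the μ-th binary
-- digit of j is 1. If 2^(μ+1) divides n + 1, the last μ + 1 binary digits of n are
-- all 1, so j and n - j have complementary μ-th digits. Hence the terms for j and
-- n - j of f_{2^μ,n}(-1), namely C(n,j)(-1)^C(j,2^μ) and C(n,n-j)(-1)^C(n-j,2^μ),
-- cancel, and the sum vanishes.
module Submission where

open import Defs
open import Data.Nat using (ℕ; zero; suc; _≥_; _≤_; _∸_; _^_; _*_; z≤n; ⌊_/2⌋; parity)
open import Data.Integer using (ℤ; +_; -_; -1ℤ; 0ℤ)
import Data.Integer as ℤ
import Data.Integer.Properties as ℤ
import Data.Nat as ℕ
import Data.Nat.Properties as ℕ
open import Data.Nat.Combinatorics using (_C_; nCk+nC[k+1]≡[n+1]C[k+1]; nC1≡n; nCk≡nC[n∸k])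
open import Data.Nat.Divisibility using (_∣_; divides; ∣-trans; *-cancelˡ-∣; m∣m*n)
open import Data.Parity using (0ℙ; 1ℙ; _⁻¹)
import Data.Parity as ℙ
import Data.Parity.Properties as ℙ
open import Data.Empty using (⊥-elim)
open import Relation.Binary.PropositionalEquality

double : ℕ → ℕ
double zero    = zero
double (suc n) = suc (suc (double n))

double-distrib-+ : ∀ m n → double (m ℕ.+ n) ≡ double m ℕ.+ double n
double-distrib-+ zero    n = refl
double-distrib-+ (suc m) n = cong (λ x → suc (suc x)) (double-distrib-+ m n)

double≡2* : ∀ n → double n ≡ 2 * n
double≡2* zero    = refl
double≡2* (suc n) = cong suc (trans (cong suc (double≡2* n)) (sym (ℕ.+-suc n (n ℕ.+ 0))))

parity-double : ∀ n → parity (double n) ≡ 0ℙ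
parity-double zero    = refl
parity-double (suc n) = parity-double n

parity-suc-double : ∀ n → parity (suc (double n)) ≡ 1ℙ
parity-suc-double zero    = refl
parity-suc-double (suc n) = parity-suc-double n

⌊double/2⌋≡n : ∀ n → ⌊ double n /2⌋ ≡ n
⌊double/2⌋≡n zero    = refl
⌊double/2⌋≡n (suc n) = cong suc (⌊double/2⌋≡n n)

⌊suc-double/2⌋≡n : ∀ n → ⌊ suc (double n) /2⌋ ≡ n
⌊suc-double/2⌋≡n zero    = refl
⌊suc-double/2⌋≡n (suc n) = cong suc (⌊suc-double/2⌋≡n n)

2*m∣double[n]⇒m∣n : ∀ {m n} → 2 * m ∣ double n → m ∣ n
2*m∣double[n]⇒m∣n {m} {n} h = *-cancelˡ-∣ 2 (subst (2 * m ∣_) (double≡2* n) h)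

1+[1+2m]+2n≡double[1+m+n] : ∀ m n → suc (suc (double m) ℕ.+ double n) ≡ double (suc (m ℕ.+ n))
1+[1+2m]+2n≡double[1+m+n] m n = cong (λ x → suc (suc x)) (sym (double-distrib-+ m n))

1+2m+[1+2n]≡double[1+m+n] : ∀ m n → suc (double m ℕ.+ suc (double n)) ≡ double (suc (m ℕ.+ n))
1+2m+[1+2n]≡double[1+m+n] m n =
  trans (cong suc (ℕ.+-suc (double m) (double n))) (1+[1+2m]+2n≡double[1+m+n] m n)

data EvenOdd : ℕ → Set where
  even : ∀ n → EvenOdd (double n)
  odd  : ∀ n → EvenOdd (suc (double n))

evenOdd : ∀ n → EvenOdd n
evenOdd zero = even zero
evenOdd (suc n) with evenOdd n
... | even m = odd m
... | odd m  = even (suc m)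

2∣⇒parity≡0ℙ : ∀ {n} → 2 ∣ n → parity n ≡ 0ℙ
2∣⇒parity≡0ℙ (divides q refl) = trans (ℙ.*-homo-* q 2) (ℙ.*-zeroʳ (parity q))

parity-complement : ∀ i j → 2 ∣ suc (i ℕ.+ j) → parity i ≡ parity j ⁻¹
parity-complement i j 2∣ = ℙ.+-cancelʳ-≡ (parity j) (parity i) (parity j ⁻¹) (begin
  parity i ℙ.+ parity j     ≡⟨ ℙ.+-homo-+ i j ⟨
  parity (i ℕ.+ j)          ≡⟨ ℙ.suc-homo-⁻¹ (i ℕ.+ j) ⟨
  parity (suc (i ℕ.+ j)) ⁻¹ ≡⟨ cong _⁻¹ (2∣⇒parity≡0ℙ 2∣) ⟩
  1ℙ                        ≡⟨ ℙ.p⁻¹+p≡1ℙ (parity j) ⟨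
  parity j ⁻¹ ℙ.+ parity j  ∎)
  where open ≡-Reasoning

parity-pascal : ∀ n k → parity (suc n C suc k) ≡ parity (n C k) ℙ.+ parity (n C suc k)
parity-pascal n k =
  trans (cong parity (sym (nCk+nC[k+1]≡[n+1]C[k+1] n k))) (ℙ.+-homo-+ (n C k) (n C suc k))

parity-[2m]C[2n+1]≡0ℙ    : ∀ m n → parity (double m C suc (double n)) ≡ 0ℙ
parity-[2m+1]C[2n+1]≡mCn : ∀ m n → parity (suc (double m) C suc (double n)) ≡ parity (m C n)
parity-[2m]C[2n]≡mCn     : ∀ m n → parity (double m C double n) ≡ parity (m C n)
parity-[2m+1]C[2n]≡mCn   : ∀ m n → parity (suc (double m) C double n) ≡ parity (m C n)

parity-[2m]C[2n+1]≡0ℙ zero    n = refl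
parity-[2m]C[2n+1]≡0ℙ (suc m) n = begin
  parity (double (suc m) C suc (double n))
    ≡⟨ parity-pascal (suc (double m)) (double n) ⟩
  parity (suc (double m) C double n) ℙ.+ parity (suc (double m) C suc (double n))
    ≡⟨ cong₂ ℙ._+_ (parity-[2m+1]C[2n]≡mCn m n) (parity-[2m+1]C[2n+1]≡mCn m n) ⟩
  parity (m C n) ℙ.+ parity (m C n)
    ≡⟨ ℙ.p+p≡0ℙ (parity (m C n)) ⟩
  0ℙ ∎
  where open ≡-Reasoning

parity-[2m+1]C[2n+1]≡mCn m n = begin
  parity (suc (double m) C suc (double n))
    ≡⟨ parity-pascal (double m) (double n) ⟩
  parity (double m C double n) ℙ.+ parity (double m C suc (double n))
    ≡⟨ cong₂ ℙ._+_ (parity-[2m]C[2n]≡mCn m n) (parity-[2m]C[2n+1]≡0ℙ m n) ⟩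
  parity (m C n) ℙ.+ 0ℙ
    ≡⟨ ℙ.+-identityʳ (parity (m C n)) ⟩
  parity (m C n) ∎
  where open ≡-Reasoning

parity-[2m]C[2n]≡mCn zero    zero    = refl
parity-[2m]C[2n]≡mCn zero    (suc n) = refl
parity-[2m]C[2n]≡mCn (suc m) zero    = refl
parity-[2m]C[2n]≡mCn (suc m) (suc n) = begin
  parity (double (suc m) C double (suc n))
    ≡⟨ parity-pascal (suc (double m)) (suc (double n)) ⟩
  parity (suc (double m) C suc (double n)) ℙ.+ parity (suc (double m) C double (suc n))
    ≡⟨ cong₂ ℙ._+_ (parity-[2m+1]C[2n+1]≡mCn m n) (parity-[2m+1]C[2n]≡mCn m (suc n)) ⟩
  parity (m C n) ℙ.+ parity (m C suc n)
    ≡⟨ parity-pascal m n ⟨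
  parity (suc m C suc n) ∎
  where open ≡-Reasoning

parity-[2m+1]C[2n]≡mCn m zero    = refl
parity-[2m+1]C[2n]≡mCn m (suc n) = begin
  parity (suc (double m) C double (suc n))
    ≡⟨ parity-pascal (double m) (suc (double n)) ⟩
  parity (double m C suc (double n)) ℙ.+ parity (double m C double (suc n))
    ≡⟨ cong₂ ℙ._+_ (parity-[2m]C[2n+1]≡0ℙ m n) (parity-[2m]C[2n]≡mCn m (suc n)) ⟩
  parity (m C suc n) ∎
  where open ≡-Reasoning

parity-C-double : ∀ j n → parity (j C double n) ≡ parity (⌊ j /2⌋ C n)
parity-C-double j n with evenOdd j
... | even m rewrite ⌊double/2⌋≡n m     = parity-[2m]C[2n]≡mCn m n
... | odd m  rewrite ⌊suc-double/2⌋≡n m = parity-[2m+1]C[2n]≡mCn m n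

⌊_/2^_⌋ : ℕ → ℕ → ℕ
⌊ j /2^ zero  ⌋ = j
⌊ j /2^ suc μ ⌋ = ⌊ ⌊ j /2⌋ /2^ μ ⌋

parity-C-2^ : ∀ μ j → parity (j C 2 ^ μ) ≡ parity ⌊ j /2^ μ ⌋
parity-C-2^ zero    j = cong parity (nC1≡n j)
parity-C-2^ (suc μ) j = begin
  parity (j C 2 * 2 ^ μ)          ≡⟨ cong (λ k → parity (j C k)) (double≡2* (2 ^ μ)) ⟨
  parity (j C double (2 ^ μ))     ≡⟨ parity-C-double j (2 ^ μ) ⟩
  parity (⌊ j /2⌋ C 2 ^ μ)        ≡⟨ parity-C-2^ μ ⌊ j /2⌋ ⟩
  parity ⌊ ⌊ j /2⌋ /2^ μ ⌋        ∎
  where open ≡-Reasoning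

digit-complement : ∀ μ i j → 2 ^ suc μ ∣ suc (i ℕ.+ j) →
                   parity ⌊ i /2^ μ ⌋ ≡ parity ⌊ j /2^ μ ⌋ ⁻¹
digit-complement zero    i j 2^μ⁺¹∣ = parity-complement i j 2^μ⁺¹∣
digit-complement (suc μ) i j 2^μ⁺¹∣
  with evenOdd i | evenOdd j | parity-complement i j (∣-trans (m∣m*n (2 ^ suc μ)) 2^μ⁺¹∣)
... | even a | even b | opposite = ⊥-elim (ℙ.p≢p⁻¹ 0ℙ
  (trans (sym (parity-double a)) (trans opposite (cong _⁻¹ (parity-double b)))))
... | odd a  | odd b  | opposite = ⊥-elim (ℙ.p≢p⁻¹ 1ℙ
  (trans (sym (parity-suc-double a)) (trans opposite (cong _⁻¹ (parity-suc-double b)))))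
... | odd a  | even b | _ rewrite ⌊suc-double/2⌋≡n a | ⌊double/2⌋≡n b =
  digit-complement μ a b (2*m∣double[n]⇒m∣n
    (subst (2 ^ suc (suc μ) ∣_) (1+[1+2m]+2n≡double[1+m+n] a b) 2^μ⁺¹∣))
... | even a | odd b  | _ rewrite ⌊double/2⌋≡n a | ⌊suc-double/2⌋≡n b =
  digit-complement μ a b (2*m∣double[n]⇒m∣n
    (subst (2 ^ suc (suc μ) ∣_) (1+2m+[1+2n]≡double[1+m+n] a b) 2^μ⁺¹∣))

-1^[2+n]≡-1^n : ∀ n → -1ℤ ℤ.^ suc (suc n) ≡ -1ℤ ℤ.^ n
-1^[2+n]≡-1^n n = trans (ℤ.-1*i≡-i _) (trans (cong -_ (ℤ.-1*i≡-i _)) (ℤ.neg-involutive _))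

-1^-parity⁻¹ : ∀ m n → parity m ≡ parity n ⁻¹ → -1ℤ ℤ.^ m ≡ - (-1ℤ ℤ.^ n)
-1^-parity⁻¹ zero          (suc zero)    _ = refl
-1^-parity⁻¹ (suc zero)    zero          _ = refl
-1^-parity⁻¹ (suc (suc m)) n             p = trans (-1^[2+n]≡-1^n m) (-1^-parity⁻¹ m n p)
-1^-parity⁻¹ m             (suc (suc n)) p =
  trans (-1^-parity⁻¹ m n p) (cong -_ (sym (-1^[2+n]≡-1^n n)))
-1^-parity⁻¹ zero          zero          p = ⊥-elim (ℙ.p≢p⁻¹ 0ℙ p)
-1^-parity⁻¹ (suc zero)    (suc zero)    p = ⊥-elim (ℙ.p≢p⁻¹ 1ℙ p)

sumTo-cong : ∀ n {g h : ℕ → ℤ} → (∀ j → j ≤ n → g j ≡ h j) → sumTo n g ≡ sumTo n h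
sumTo-cong zero    g≗h = g≗h 0 z≤n
sumTo-cong (suc n) g≗h =
  cong₂ ℤ._+_ (sumTo-cong n (λ j j≤n → g≗h j (ℕ.m≤n⇒m≤1+n j≤n))) (g≗h (suc n) ℕ.≤-refl)

sumTo-neg : ∀ n (g : ℕ → ℤ) → sumTo n (λ j → - g j) ≡ - sumTo n g
sumTo-neg zero    g = refl
sumTo-neg (suc n) g =
  trans (cong (ℤ._+ - g (suc n)) (sumTo-neg n g)) (sym (ℤ.neg-distrib-+ (sumTo n g) (g (suc n))))

sumTo-suc-shift : ∀ n (g : ℕ → ℤ) → sumTo (suc n) g ≡ g 0 ℤ.+ sumTo n (λ j → g (suc j))
sumTo-suc-shift zero    g = refl
sumTo-suc-shift (suc n) g =
  trans (cong (ℤ._+ g (suc (suc n))) (sumTo-suc-shift n g))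
        (ℤ.+-assoc (g 0) (sumTo n (λ j → g (suc j))) (g (suc (suc n))))

sumTo-reverse : ∀ n (g : ℕ → ℤ) → sumTo n (λ j → g (n ∸ j)) ≡ sumTo n g
sumTo-reverse zero    g = refl
sumTo-reverse (suc n) g = begin
  sumTo n (λ j → g (suc n ∸ j)) ℤ.+ g (suc n ∸ suc n)
    ≡⟨ cong₂ ℤ._+_ (sumTo-cong n (λ j j≤n → cong g (ℕ.+-∸-assoc 1 j≤n))) (cong g (ℕ.n∸n≡0 n)) ⟩
  sumTo n (λ j → g (suc (n ∸ j))) ℤ.+ g 0
    ≡⟨ cong (ℤ._+ g 0) (sumTo-reverse n (λ j → g (suc j))) ⟩
  sumTo n (λ j → g (suc j)) ℤ.+ g 0
    ≡⟨ ℤ.+-comm _ (g 0) ⟩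
  g 0 ℤ.+ sumTo n (λ j → g (suc j))
    ≡⟨ sumTo-suc-shift n g ⟨
  sumTo (suc n) g ∎
  where open ≡-Reasoning

i≡-i⇒i≡0 : ∀ {i} → i ≡ - i → i ≡ 0ℤ
i≡-i⇒i≡0 {+ zero} _ = refl

sumTo-antisymmetric≡0 : ∀ n (g : ℕ → ℤ) → (∀ j → j ≤ n → g (n ∸ j) ≡ - g j) → sumTo n g ≡ 0ℤ
sumTo-antisymmetric≡0 n g anti = i≡-i⇒i≡0 (begin
  sumTo n g                     ≡⟨ sumTo-reverse n g ⟨
  sumTo n (λ j → g (n ∸ j))     ≡⟨ sumTo-cong n anti ⟩
  sumTo n (λ j → - g j)         ≡⟨ sumTo-neg n g ⟩
  - sumTo n g                   ∎)
  where open ≡-Reasoning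

f[-1]≡0 : ∀ m n → (∀ j → j ≤ n → parity ((n ∸ j) C m) ≡ parity (j C m) ⁻¹) → f m n -1ℤ ≡ 0ℤ
f[-1]≡0 m n anti = sumTo-antisymmetric≡0 n _ λ j j≤n → begin
  + (n C (n ∸ j)) ℤ.* -1ℤ ℤ.^ ((n ∸ j) C m)
    ≡⟨ cong₂ (λ c s → + c ℤ.* s) (sym (nCk≡nC[n∸k] j≤n))
             (-1^-parity⁻¹ ((n ∸ j) C m) (j C m) (anti j j≤n)) ⟩
  + (n C j) ℤ.* - (-1ℤ ℤ.^ (j C m))
    ≡⟨ ℤ.neg-distribʳ-* (+ (n C j)) (-1ℤ ℤ.^ (j C m)) ⟨
  - (+ (n C j) ℤ.* -1ℤ ℤ.^ (j C m)) ∎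
  where open ≡-Reasoning

parity-C-2^-reflect : ∀ μ {n j} → 2 ^ suc μ ∣ suc n → j ≤ n →
                      parity ((n ∸ j) C 2 ^ μ) ≡ parity (j C 2 ^ μ) ⁻¹
parity-C-2^-reflect μ {n} {j} 2^μ⁺¹∣1+n j≤n = begin
  parity ((n ∸ j) C 2 ^ μ)  ≡⟨ parity-C-2^ μ (n ∸ j) ⟩
  parity ⌊ n ∸ j /2^ μ ⌋    ≡⟨ digit-complement μ (n ∸ j) j 2^μ⁺¹∣1+[n∸j]+j ⟩
  parity ⌊ j /2^ μ ⌋ ⁻¹     ≡⟨ cong _⁻¹ (parity-C-2^ μ j) ⟨
  parity (j C 2 ^ μ) ⁻¹     ∎
  where
    open ≡-Reasoning
    2^μ⁺¹∣1+[n∸j]+j : 2 ^ suc μ ∣ suc (n ∸ j ℕ.+ j)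
    2^μ⁺¹∣1+[n∸j]+j = subst (λ m → 2 ^ suc μ ∣ suc m) (sym (ℕ.m∸n+n≡m j≤n)) 2^μ⁺¹∣1+n

corollary3p5 : (μ k : ℕ) → μ ≥ 1 → k ≥ 1 →
    f (2 ^ μ) (k * 2 ^ suc μ ∸ 1) (- (+ 1)) ≡ + 0
corollary3p5 μ k _ k≥1 =
  f[-1]≡0 (2 ^ μ) n (λ j → parity-C-2^-reflect μ (divides k 1+n≡k*2^μ⁺¹))
  where
    n : ℕ
    n = k * 2 ^ suc μ ∸ 1
    1+n≡k*2^μ⁺¹ : suc n ≡ k * 2 ^ suc μ
    1+n≡k*2^μ⁺¹ = ℕ.m+[n∸m]≡n (ℕ.*-mono-≤ k≥1 (ℕ.m^n>0 2 (suc μ)))
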